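{- Let $H$ be a finite subgroup of order $n$ of $\mathbb{R}/\mathbb{Z}$ or of $\mathbb{R}/\mathbb{Z}\times\mathbb{Z}_2$, let $c\in H$, and let $m_1,\dots,m_k$ be positive integers. Then $[m_1,\dots,m_k;c]\leqslant 2m_k(k-1)!\binom{n}{k-1}$.
   Context: $[m_1,\dots,m_k;c]$ denotes the number of ordered $k$-tuples $(a_1,\dots,a_k)$ of pairwise distinct elements of $H$ satisfying $m_1a_1\oplus\dots\oplus m_ka_k=c$, where $\oplus$ is the group operation and $ma$ denotes $a\oplus\dots\oplus a$ ($m$ times).
   Formalization: The subgroup H is taken in ℚ/ℤ or ℚ/ℤ × ℤ₂, with elements represented by rationals in [0,1), rather than in $\mathbb{R}/\mathbb{Z}$ or $\mathbb{R}/\mathbb{Z}\times\mathbb{Z}_2$. -}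

module Defs where

open import Data.Nat using (ℕ; zero; suc)
open import Data.Bool using (Bool; false; _xor_)
import Data.Bool.Properties as BoolP
open import Data.Integer using (ℤ)
open import Data.Rational using (ℚ; 0ℚ; floor; _+_; _-_; -_; _/_)
import Data.Rational.Properties as ℚP
open import Data.Product using (_×_; _,_; proj₁)
open import Data.Product.Properties using (≡-dec)
open import Data.List using (List; []; _∷_; [_]; map; concatMap; filter; length)
open import Data.List.Relation.Unary.All using (All)
open import Data.List.Relation.Unary.AllPairs using (AllPairs; allPairs?)
open import Data.List.Relation.Unary.Unique.Propositional using (Unique)
open import Data.List.Membership.Propositional using (_∈_)
open import Data.Vec using (Vec; []; _∷_; toList)
open import Relation.Binary.PropositionalEquality using (_≡_; _≢_)
open import Relation.Binary.Definitions using (DecidableEquality)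
open import Relation.Nullary.Decidable using (_×-dec_; ¬?)

module Count {A : Set} (_≟_ : DecidableEquality A)
             (_⊕_ : A → A → A) (e : A) where

  mul : ℕ → A → A
  mul zero    a = e
  mul (suc m) a = a ⊕ mul m a

  linComb : ∀ {k} → Vec ℕ k → Vec A k → A
  linComb []       []       = e
  linComb (m ∷ ms) (a ∷ as) = mul m a ⊕ linComb ms as

  tuples : List A → (k : ℕ) → List (Vec A k)
  tuples H zero    = [ [] ]
  tuples H (suc k) = concatMap (λ a → map (a ∷_) (tuples H k)) H

  Distinct : ∀ {k} → Vec A k → Set
  Distinct v = AllPairs _≢_ (toList v)

  count : ∀ {k} → Vec ℕ k → A → List A → ℕ
  count {k} ms c H =
    length (filter (λ v → allPairs? (λ x y → ¬? (x ≟ y)) (toList v)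
                          ×-dec (linComb ms v ≟ c))
                   (tuples H k))

  IsFinSubgroup : (A → A) → (A → Set) → List A → ℕ → Set
  IsFinSubgroup neg Elem H n =
    Unique H × length H ≡ n × All Elem H × e ∈ H
    × (∀ {x y} → x ∈ H → y ∈ H → (x ⊕ y) ∈ H)
    × (∀ {x} → x ∈ H → neg x ∈ H)

-- ℝ/ℤ: its finite subgroups lie in the torsion part ℚ/ℤ, whose elements
-- we represent canonically by rationals q with 0 ≤ q < 1 (frac q ≡ q).

frac : ℚ → ℚ
frac q = q - (floor q / 1)

IsT : ℚ → Set
IsT q = frac q ≡ q

_⊕T_ : ℚ → ℚ → ℚ
x ⊕T y = frac (x + y)

negT : ℚ → ℚ
negT x = frac (- x)

module CountT = Count ℚP._≟_ _⊕T_ 0ℚ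

-- ℝ/ℤ × ℤ₂ (torsion part ℚ/ℤ × ℤ₂), ℤ₂ = Bool with xor

T2 : Set
T2 = ℚ × Bool

IsT2 : T2 → Set
IsT2 p = IsT (proj₁ p)

_⊕T2_ : T2 → T2 → T2
(x , s) ⊕T2 (y , t) = (x ⊕T y , s xor t)

negT2 : T2 → T2
negT2 (x , s) = (negT x , s)

0T2 : T2
0T2 = (0ℚ , false)

module CountT2 = Count (≡-dec ℚP._≟_ BoolP._≟_) _⊕T2_ 0T2

{-# OPTIONS --safe #-}
module Submission where

-- Here ms has k + 1 entries, so k is the paper's k − 1. A solution (a₀, …, a_k) is pinned down by
-- its first k entries, which are distinct elements of H and so can be chosen in
-- n (n − 1) ⋯ (n − k + 1) = k! C(n, k) ways, together with its last entry x. Translations are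
-- injective, so the first k entries determine m x for the last coefficient m. In ℚ/ℤ, with x
-- represented by its fractional part in [0, 1), x is recovered from the class of m·x and from
-- ⌊m·x⌋ ∈ {0, …, m − 1}, so there are at most m choices of x; in ℚ/ℤ × ℤ₂ the ℤ₂-coordinate at
-- most doubles this.

open import Defs
import Data.Nat as ℕ
open import Function using (_∘_)
open import Relation.Binary.PropositionalEquality hiding ([_])

module ℚ/ℤ where
  open import Data.Nat using (ℕ; zero; suc)
  open import Data.Integer as ℤ using (ℤ; +_; -[1+_])
  import Data.Integer.Properties as ℤ
  open import Data.Integer.DivMod using (_%ℕ_; _/ℕ_; a≡a%ℕn+[a/ℕn]*n; n<s[n/ℕd]*d)
  open import Data.Nat.Coprimality as Coprimality using (Coprime; 1-coprimeTo)
  open import Data.Rational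
  open import Data.Rational.Properties
  open import Data.Rational.Solver using (module +-*-Solver)
  open +-*-Solver
  open CountT using (mul)

  fromℤ : ℤ → ℚ
  fromℤ z = z / 1

  coprime-1 : ∀ n → Coprime n 1
  coprime-1 n = Coprimality.sym (1-coprimeTo n)

  fromℤ≡mkℚ : ∀ z → fromℤ z ≡ mkℚ z 0 (coprime-1 ℤ.∣ z ∣)
  fromℤ≡mkℚ (+ n)    = normalize-coprime (coprime-1 n)
  fromℤ≡mkℚ -[1+ n ] = cong -_ (normalize-coprime (coprime-1 (suc n)))

  fromℤ-+ : ∀ z w → fromℤ (z ℤ.+ w) ≡ fromℤ z + fromℤ w
  fromℤ-+ z w rewrite fromℤ≡mkℚ z | fromℤ≡mkℚ w =
    cong (_/ 1) (sym (cong₂ ℤ._+_ (ℤ.*-identityʳ z) (ℤ.*-identityʳ w)))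

  fromℤ-suc : ∀ z → fromℤ (ℤ.suc z) ≡ 1ℚ + fromℤ z
  fromℤ-suc z = fromℤ-+ (+ 1) z

  fromℤ-cancel-< : ∀ {z w} → fromℤ z < fromℤ w → z ℤ.< w
  fromℤ-cancel-< {z} {w} p rewrite fromℤ≡mkℚ z | fromℤ≡mkℚ w with p
  ... | *<* z<w = subst₂ ℤ._<_ (ℤ.*-identityʳ z) (ℤ.*-identityʳ w) z<w

  fromℤ-cancel-<-suc : ∀ {z w} → fromℤ z < fromℤ (ℤ.suc w) → z ℤ.≤ w
  fromℤ-cancel-<-suc {z} {w} p = subst (z ℤ.≤_) (ℤ.pred-suc w) (ℤ.i<j⇒i≤pred[j] {j = ℤ.suc w} (fromℤ-cancel-< p))

  floor≡/ℕ : ∀ n d-1 .(c : Coprime ℤ.∣ n ∣ (suc d-1)) → floor (mkℚ n d-1 c) ≡ n /ℕ suc d-1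
  floor≡/ℕ n d-1 c = ℤ.*-identityˡ (n /ℕ suc d-1)

  floor-≤ : ∀ q → fromℤ (floor q) ≤ q
  floor-≤ (mkℚ n d-1 c) rewrite floor≡/ℕ n d-1 c | fromℤ≡mkℚ (n /ℕ suc d-1) = *≤* (begin
    (n /ℕ suc d-1) ℤ.* + suc d-1                     ≤⟨ ℤ.i≤j+i _ (+ (n %ℕ suc d-1)) ⟩
    + (n %ℕ suc d-1) ℤ.+ (n /ℕ suc d-1) ℤ.* + suc d-1 ≡⟨ a≡a%ℕn+[a/ℕn]*n n (suc d-1) ⟨
    n                                                 ≡⟨ ℤ.*-identityʳ n ⟨
    n ℤ.* + 1                                         ∎)
    where open ℤ.≤-Reasoning

  <-floor-suc : ∀ q → q < fromℤ (ℤ.suc (floor q))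
  <-floor-suc (mkℚ n d-1 c) rewrite floor≡/ℕ n d-1 c | fromℤ≡mkℚ (ℤ.suc (n /ℕ suc d-1)) =
    *<* (subst (ℤ._< ℤ.suc (n /ℕ suc d-1) ℤ.* + suc d-1) (sym (ℤ.*-identityʳ n)) (n<s[n/ℕd]*d n (suc d-1)))

  floor-unique : ∀ {r} z → 0ℚ ≤ r → r < 1ℚ → floor (r + fromℤ z) ≡ z
  floor-unique {r} z 0≤r r<1 = ℤ.≤-antisym floor≤z z≤floor
    where
    floor≤z : floor (r + fromℤ z) ℤ.≤ z
    floor≤z = fromℤ-cancel-<-suc (begin-strict
      fromℤ (floor (r + fromℤ z)) ≤⟨ floor-≤ (r + fromℤ z) ⟩
      r + fromℤ z                 <⟨ +-monoˡ-< (fromℤ z) r<1 ⟩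
      1ℚ + fromℤ z                ≡⟨ fromℤ-suc z ⟨
      fromℤ (ℤ.suc z)             ∎)
      where open ≤-Reasoning
    z≤floor : z ℤ.≤ floor (r + fromℤ z)
    z≤floor = fromℤ-cancel-<-suc (begin-strict
      fromℤ z                                 ≡⟨ +-identityˡ (fromℤ z) ⟨
      0ℚ + fromℤ z                            ≤⟨ +-monoˡ-≤ (fromℤ z) 0≤r ⟩
      r + fromℤ z                             <⟨ <-floor-suc (r + fromℤ z) ⟩
      fromℤ (ℤ.suc (floor (r + fromℤ z)))     ∎)
      where open ≤-Reasoning

  frac+floor : ∀ q → frac q + fromℤ (floor q) ≡ q
  frac+floor q = solve 2 (λ q f → (q :- f) :+ f := q) refl q (fromℤ (floor q))

  0≤frac : ∀ q → 0ℚ ≤ frac q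
  0≤frac q = subst (_≤ frac q) (+-inverseʳ (fromℤ (floor q))) (+-monoˡ-≤ (- fromℤ (floor q)) (floor-≤ q))

  frac<1 : ∀ q → frac q < 1ℚ
  frac<1 q = begin-strict
    q - f                     <⟨ +-monoˡ-< (- f) (<-floor-suc q) ⟩
    fromℤ (ℤ.suc (floor q)) - f ≡⟨ cong (_- f) (fromℤ-suc (floor q)) ⟩
    (1ℚ + f) - f              ≡⟨ solve 1 (λ f → (con 1ℚ :+ f) :- f := con 1ℚ) refl f ⟩
    1ℚ                        ∎
    where
    open ≤-Reasoning
    f = fromℤ (floor q)

  frac-unique : ∀ {r} z → 0ℚ ≤ r → r < 1ℚ → frac (r + fromℤ z) ≡ r
  frac-unique {r} z 0≤r r<1 = begin
    (r + fromℤ z) - fromℤ (floor (r + fromℤ z)) ≡⟨ cong (λ w → (r + fromℤ z) - fromℤ w) (floor-unique z 0≤r r<1) ⟩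
    (r + fromℤ z) - fromℤ z                     ≡⟨ solve 2 (λ r f → (r :+ f) :- f := r) refl r (fromℤ z) ⟩
    r                                           ∎
    where open ≡-Reasoning

  frac-+-fromℤ : ∀ q z → frac (q + fromℤ z) ≡ frac q
  frac-+-fromℤ q z = begin
    frac (q + fromℤ z)                          ≡⟨ cong (λ p → frac (p + fromℤ z)) (frac+floor q) ⟨
    frac ((frac q + fromℤ (floor q)) + fromℤ z) ≡⟨ cong frac (+-assoc (frac q) _ _) ⟩
    frac (frac q + (fromℤ (floor q) + fromℤ z)) ≡⟨ cong (λ p → frac (frac q + p)) (fromℤ-+ (floor q) z) ⟨
    frac (frac q + fromℤ (floor q ℤ.+ z))       ≡⟨ frac-unique (floor q ℤ.+ z) (0≤frac q) (frac<1 q) ⟩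
    frac q                                      ∎
    where open ≡-Reasoning

  frac-idem : ∀ q → frac (frac q) ≡ frac q
  frac-idem q = trans (cong frac (sym (+-identityʳ (frac q)))) (frac-unique (+ 0) (0≤frac q) (frac<1 q))

  frac-+-frac : ∀ p q → frac (p + frac q) ≡ frac (p + q)
  frac-+-frac p q = begin
    frac (p + frac q)                     ≡⟨ frac-+-fromℤ (p + frac q) (floor q) ⟨
    frac ((p + frac q) + fromℤ (floor q)) ≡⟨ cong frac (+-assoc p (frac q) _) ⟩
    frac (p + (frac q + fromℤ (floor q))) ≡⟨ cong (λ r → frac (p + r)) (frac+floor q) ⟩
    frac (p + q)                          ∎
    where open ≡-Reasoning

  ⊕T-canonical : ∀ x y → IsT (x ⊕T y)
  ⊕T-canonical x y = frac-idem (x + y)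

  canonical-unique : ∀ {x y} z w → IsT x → IsT y → x + fromℤ z ≡ y + fromℤ w → x ≡ y
  canonical-unique {x} {y} z w x-canonical y-canonical eq = begin
    x                  ≡⟨ x-canonical ⟨
    frac x             ≡⟨ frac-+-fromℤ x z ⟨
    frac (x + fromℤ z) ≡⟨ cong frac eq ⟩
    frac (y + fromℤ w) ≡⟨ frac-+-fromℤ y w ⟩
    frac y             ≡⟨ y-canonical ⟩
    y                  ∎
    where open ≡-Reasoning

  ⊕T-cancelˡ : ∀ a {x y} → IsT x → IsT y → a ⊕T x ≡ a ⊕T y → x ≡ y
  ⊕T-cancelˡ a {x} {y} x-canonical y-canonical eq =
    canonical-unique (floor (a + y)) (floor (a + x)) x-canonical y-canonical (begin
      x + g                       ≡⟨ solve 4 (λ a x f g → x :+ g := ((a :+ x) :- f) :+ ((f :+ g) :- a)) refl a x f g ⟩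
      (a ⊕T x) + ((f + g) - a)    ≡⟨ cong (_+ ((f + g) - a)) eq ⟩
      (a ⊕T y) + ((f + g) - a)    ≡⟨ solve 4 (λ a y f g → ((a :+ y) :- g) :+ ((f :+ g) :- a) := y :+ f) refl a y f g ⟩
      y + f                       ∎)
    where
    open ≡-Reasoning
    f = fromℤ (floor (a + x))
    g = fromℤ (floor (a + y))

  mul≡frac : ∀ m x → mul m x ≡ frac (fromℤ (+ m) * x)
  mul≡frac zero    x = cong frac (sym (*-zeroˡ x))
  mul≡frac (suc m) x = begin
    frac (x + mul m x)                   ≡⟨ cong (λ p → frac (x + p)) (mul≡frac m x) ⟩
    frac (x + frac (fromℤ (+ m) * x))    ≡⟨ frac-+-frac x (fromℤ (+ m) * x) ⟩
    frac (x + fromℤ (+ m) * x)           ≡⟨ cong frac (distrib x (fromℤ (+ m))) ⟩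
    frac ((1ℚ + fromℤ (+ m)) * x)        ≡⟨ cong (λ p → frac (p * x)) (fromℤ-suc (+ m)) ⟨
    frac (fromℤ (+ suc m) * x)           ∎
    where
    open ≡-Reasoning
    distrib : ∀ x M → x + M * x ≡ (1ℚ + M) * x
    distrib = solve 2 (λ x M → x :+ M :* x := (con 1ℚ :+ M) :* x) refl

  mul⊕0≡frac : ∀ m x → mul m x ⊕T 0ℚ ≡ frac (fromℤ (+ m) * x)
  mul⊕0≡frac m x = begin
    frac (mul m x + 0ℚ)                 ≡⟨ cong frac (+-identityʳ (mul m x)) ⟩
    frac (mul m x)                      ≡⟨ cong frac (mul≡frac m x) ⟩
    frac (frac (fromℤ (+ m) * x))       ≡⟨ frac-idem (fromℤ (+ m) * x) ⟩
    frac (fromℤ (+ m) * x)              ∎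
    where open ≡-Reasoning

  fromℤ-positive : ∀ m .{{_ : ℕ.NonZero m}} → Positive (fromℤ (+ m))
  fromℤ-positive (suc m) rewrite fromℤ≡mkℚ (+ suc m) = _

  canonical⇒0≤ : ∀ {x} → IsT x → 0ℚ ≤ x
  canonical⇒0≤ {x} x-canonical = subst (0ℚ ≤_) x-canonical (0≤frac x)

  canonical⇒<1 : ∀ {x} → IsT x → x < 1ℚ
  canonical⇒<1 {x} x-canonical = subst (_< 1ℚ) x-canonical (frac<1 x)

  scaleKey : ℕ → ℚ → ℕ
  scaleKey m x = ℤ.∣ floor (fromℤ (+ m) * x) ∣

  module _ (m : ℕ) .{{_ : ℕ.NonZero m}} where
    private
      M = fromℤ (+ m)
      instance
        M-positive : Positive M
        M-positive = fromℤ-positive m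

    0≤floor-scaled : ∀ {x} → IsT x → ℤ.0ℤ ℤ.≤ floor (M * x)
    0≤floor-scaled {x} x-canonical = fromℤ-cancel-<-suc (begin-strict
      0ℚ                          ≡⟨ *-zeroʳ M ⟨
      M * 0ℚ                      ≤⟨ *-monoˡ-≤-nonNeg M {{pos⇒nonNeg M}} (canonical⇒0≤ x-canonical) ⟩
      M * x                       <⟨ <-floor-suc (M * x) ⟩
      fromℤ (ℤ.suc (floor (M * x))) ∎)
      where open ≤-Reasoning

    floor-scaled<m : ∀ {x} → IsT x → floor (M * x) ℤ.< + m
    floor-scaled<m {x} x-canonical = fromℤ-cancel-< (begin-strict
      fromℤ (floor (M * x)) ≤⟨ floor-≤ (M * x) ⟩
      M * x                 <⟨ *-monoʳ-<-pos M (canonical⇒<1 x-canonical) ⟩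
      M * 1ℚ                ≡⟨ *-identityʳ M ⟩
      M                     ∎)
      where open ≤-Reasoning

    scaleKey<m : ∀ {x} → IsT x → scaleKey m x ℕ.< m
    scaleKey<m {x} x-canonical = ℤ.drop‿+<+ (begin-strict
      + scaleKey m x  ≡⟨ ℤ.0≤i⇒+∣i∣≡i (0≤floor-scaled x-canonical) ⟩
      floor (M * x)   <⟨ floor-scaled<m x-canonical ⟩
      + m             ∎)
      where open ℤ.≤-Reasoning

    scaleKey-injective : ∀ {x y} → IsT x → IsT y → mul m x ⊕T 0ℚ ≡ mul m y ⊕T 0ℚ →
      scaleKey m x ≡ scaleKey m y → x ≡ y
    scaleKey-injective {x} {y} x-canonical y-canonical same-multiple same-key =
      ≤-antisym (*-cancelˡ-≤-pos M (≤-reflexive Mx≡My)) (*-cancelˡ-≤-pos M (≤-reflexive (sym Mx≡My)))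
      where
      open ≡-Reasoning
      same-frac : frac (M * x) ≡ frac (M * y)
      same-frac = trans (sym (mul⊕0≡frac m x)) (trans same-multiple (mul⊕0≡frac m y))
      same-floor : floor (M * x) ≡ floor (M * y)
      same-floor = begin
        floor (M * x)     ≡⟨ ℤ.0≤i⇒+∣i∣≡i (0≤floor-scaled x-canonical) ⟨
        + scaleKey m x    ≡⟨ cong +_ same-key ⟩
        + scaleKey m y    ≡⟨ ℤ.0≤i⇒+∣i∣≡i (0≤floor-scaled y-canonical) ⟩
        floor (M * y)     ∎
      Mx≡My : M * x ≡ M * y
      Mx≡My = begin
        M * x                                ≡⟨ frac+floor (M * x) ⟨
        frac (M * x) + fromℤ (floor (M * x)) ≡⟨ cong₂ (λ p z → p + fromℤ z) same-frac same-floor ⟩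
        frac (M * y) + fromℤ (floor (M * y)) ≡⟨ frac+floor (M * y) ⟩
        M * y                                ∎

open import Data.Nat using (ℕ; zero; suc; pred; _+_; _*_; _∸_; _≤_; _<_; _>_; z≤n; s≤s; NonZero; _!)
import Data.Nat.Properties as ℕ
open import Data.Nat.Combinatorics using (_C_)
open import Data.List using (List; []; _∷_; length; filter)
open import Data.List.Membership.Propositional using (_∈_)
open import Data.List.Relation.Unary.Unique.Propositional using (Unique)
open import Data.Vec using (Vec; []; _∷_; _∷ʳ_; toList; last)
open import Data.Product using (_×_; _,_; proj₁; proj₂)
open import Data.Bool using (true; false; _xor_)
open import Data.Rational using (ℚ; 0ℚ)
import Data.Rational.Properties as ℚP
open import Relation.Binary.Definitions using (DecidableEquality)
open import Relation.Unary using (Decidable)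

module TupleCounting where
  open import Data.Nat.Properties using (_!≢0)
  open import Data.Nat.Combinatorics using (_P_; nCk≡nPk/k!)
  open import Data.Nat.Combinatorics.Base using (_P′_)
  open import Data.Nat.Combinatorics.Specification
    using (nP′k≡n[n∸1P′k∸1]; nP′k≡n!/[n∸k]!; nPk≡n!/[n∸k]!; k!∣nP′k; k>n⇒nCk≡0)
  open import Data.Nat.DivMod using (_/_; m*[n/m]≡n)
  open import Algebra.Properties.CommutativeSemigroup ℕ.*-commutativeSemigroup using (x∙yz≈y∙xz)
  open import Data.Fin using (Fin; fromℕ<; toℕ)
  open import Data.Fin.Properties using (toℕ-fromℕ<; injective⇒≤)
  open import Data.List using ([_]; _++_; map; concatMap; lookup)
  import Data.List.Properties as List
  open import Data.List.Membership.Propositional.Properties using (∈-lookup; ∈-filter⁻)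
  open import Data.List.Relation.Unary.All as All using (All; []; _∷_)
  import Data.List.Relation.Unary.All.Properties as All
  open import Data.List.Relation.Unary.AllPairs using (_∷_; allPairs?)
  open import Data.List.Relation.Unary.Any using (here; there)
  import Data.List.Relation.Unary.Unique.Propositional.Properties as Unique
  open import Data.List.Relation.Binary.Sublist.Propositional using (_⊆_; ⊆-refl)
  open import Data.List.Relation.Binary.Sublist.Propositional.Properties using (filter⁺; length-mono-≤)
  import Data.Vec as Vec
  open import Data.Sum using (inj₁; inj₂)
  open import Data.Empty using (⊥-elim)
  open import Relation.Nullary using (Dec; does; yes; no; ¬?)
  open import Relation.Nullary.Decidable using (_×-dec_)
  open import Relation.Unary using (U; ∁; _∩_)
  open import Relation.Unary.Properties using (U?; ∁?; _∩?_)

  length-filter-map : ∀ {A B : Set} {P : B → Set} (P? : Decidable P) (f : A → B) xs →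
    length (filter P? (map f xs)) ≡ length (filter (P? ∘ f) xs)
  length-filter-map P? f [] = refl
  length-filter-map P? f (x ∷ xs) with does (P? (f x))
  ... | true  = cong suc (length-filter-map P? f xs)
  ... | false = length-filter-map P? f xs

  module _ {A : Set} where

    lookup-injective : ∀ {xs : List A} → Unique xs → ∀ i j → lookup xs i ≡ lookup xs j → i ≡ j
    lookup-injective (_  ∷ _)  Fin.zero    Fin.zero    _  = refl
    lookup-injective (x∉ ∷ _)  Fin.zero    (Fin.suc j) eq = ⊥-elim (All.lookup x∉ (∈-lookup j) eq)
    lookup-injective (x∉ ∷ _)  (Fin.suc i) Fin.zero    eq = ⊥-elim (All.lookup x∉ (∈-lookup i) (sym eq))
    lookup-injective (_  ∷ xs) (Fin.suc i) (Fin.suc j) eq = cong Fin.suc (lookup-injective xs i j eq)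

    injectiveOn⇒length≤ : ∀ {xs : List A} {n} (f : A → ℕ) → Unique xs →
      (∀ {x} → x ∈ xs → f x < n) → (∀ {x y} → x ∈ xs → y ∈ xs → f x ≡ f y → x ≡ y) →
      length xs ≤ n
    injectiveOn⇒length≤ {xs} f xs-unique f< f-inj = injective⇒≤ {f = key} key-injective
      where
      key : Fin (length xs) → Fin _
      key i = fromℕ< (f< (∈-lookup i))
      key-injective : ∀ {i j} → key i ≡ key j → i ≡ j
      key-injective {i} {j} eq = lookup-injective xs-unique i j (f-inj (∈-lookup i) (∈-lookup j)
        (trans (sym (toℕ-fromℕ< _)) (trans (cong toℕ eq) (toℕ-fromℕ< _))))

    filter-∩-all : ∀ {P Q : A → Set} (P? : Decidable P) (Q? : Decidable Q) {xs} →
      All Q xs → filter (P? ∩? Q?) xs ≡ filter P? xs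
    filter-∩-all P? Q? [] = refl
    filter-∩-all P? Q? {x ∷ _} (Qx ∷ Qxs) with P? x | Q? x
    ... | yes _ | yes _  = cong (x ∷_) (filter-∩-all P? Q? Qxs)
    ... | yes _ | no ¬Qx = ⊥-elim (¬Qx Qx)
    ... | no _  | _      = filter-∩-all P? Q? Qxs

    length-filter-remove : ∀ {G : A → Set} (G? : Decidable G) (_≟_ : DecidableEquality A) {a xs} →
      Unique xs → a ∈ xs → G a → length (filter G? xs) ≡ suc (length (filter (G? ∩? ∁? (a ≟_)) xs))
    length-filter-remove G? _≟_ {xs = x ∷ xs} (x∉ ∷ _) (here refl) Gx
      rewrite List.filter-accept G? {xs = xs} Gx
            | List.filter-reject (G? ∩? ∁? (x ≟_)) {xs = xs} (λ (_ , x≢x) → x≢x refl)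
            | filter-∩-all G? (∁? (x ≟_)) x∉ = refl
    length-filter-remove G? _≟_ {a} {x ∷ _} (x∉ ∷ xs-unique) (there a∈) Ga with G? x | a ≟ x
    ... | no _  | _        = length-filter-remove G? _≟_ xs-unique a∈ Ga
    ... | yes _ | yes refl = ⊥-elim (All.lookup x∉ a∈ refl)
    ... | yes _ | no _     = cong suc (length-filter-remove G? _≟_ xs-unique a∈ Ga)

    length-filter-concatMap-∷-≤ : ∀ {k b} {G : A → Set} (G? : Decidable G)
      {P : Vec A (suc k) → Set} (P? : Decidable P) (ts : List (Vec A k)) xs →
      (∀ {a w} → P (a ∷ w) → G a) →
      (∀ {a} → a ∈ xs → G a → length (filter (P? ∘ (a ∷_)) ts) ≤ b) →
      length (filter P? (concatMap (λ a → map (a ∷_) ts) xs)) ≤ length (filter G? xs) * b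
    length-filter-concatMap-∷-≤ G? P? ts [] P⇒G block = z≤n
    length-filter-concatMap-∷-≤ {b = b} {G} G? P? ts (x ∷ xs) P⇒G block = begin
      length (filter P? (map (x ∷_) ts ++ rest))
        ≡⟨ cong length (List.filter-++ P? (map (x ∷_) ts) rest) ⟩
      length (filter P? (map (x ∷_) ts) ++ filter P? rest)
        ≡⟨ List.length-++ (filter P? (map (x ∷_) ts)) ⟩
      length (filter P? (map (x ∷_) ts)) + length (filter P? rest)
        ≡⟨ cong (_+ _) (length-filter-map P? (x ∷_) ts) ⟩
      length (filter (P? ∘ (x ∷_)) ts) + length (filter P? rest)
        ≤⟨ head+rest (G? x) ⟩
      length (filter G? (x ∷ xs)) * b
        ∎
      where
      open ℕ.≤-Reasoning
      rest = concatMap (λ a → map (a ∷_) ts) xs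
      IH : length (filter P? rest) ≤ length (filter G? xs) * b
      IH = length-filter-concatMap-∷-≤ G? P? ts xs P⇒G (block ∘ there)
      head+rest : Dec (G x) →
        length (filter (P? ∘ (x ∷_)) ts) + length (filter P? rest) ≤ length (filter G? (x ∷ xs)) * b
      head+rest (yes Gx) = begin
        length (filter (P? ∘ (x ∷_)) ts) + length (filter P? rest) ≤⟨ ℕ.+-mono-≤ (block (here refl) Gx) IH ⟩
        length (x ∷ filter G? xs) * b                              ≡⟨ cong (λ ys → length ys * b) accept ⟨
        length (filter G? (x ∷ xs)) * b                            ∎
        where accept = List.filter-accept G? Gx
      head+rest (no ¬Gx) = begin
        length (filter (P? ∘ (x ∷_)) ts) + length (filter P? rest) ≡⟨ cong (λ ys → length ys + _) no-block ⟩
        length (filter P? rest)                                    ≤⟨ IH ⟩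
        length (filter G? xs) * b                                  ≡⟨ cong (λ ys → length ys * b) reject ⟨
        length (filter G? (x ∷ xs)) * b                            ∎
        where
        reject = List.filter-reject G? ¬Gx
        no-block : filter (P? ∘ (x ∷_)) ts ≡ []
        no-block = List.filter-none (P? ∘ (x ∷_)) (All.universal (λ _ → ¬Gx ∘ P⇒G) ts)

  P′-pred : ∀ n k → n * (pred n P′ k) ≡ n P′ suc k
  P′-pred zero    k = sym (cong (_* (0 P′ k)) (ℕ.0∸n≡0 k))
  P′-pred (suc n) k = sym (nP′k≡n[n∸1P′k∸1] (suc n) (suc k))

  P′-vanish : ∀ {n k} → n < k → n P′ k ≡ 0
  P′-vanish {n} {suc k} (s≤s n≤k) with ℕ.m≤n⇒m<n∨m≡n n≤k
  ... | inj₁ n<k  = trans (cong ((n ∸ k) *_) (P′-vanish n<k)) (ℕ.*-zeroʳ (n ∸ k))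
  ... | inj₂ refl = cong (_* (n P′ n)) (ℕ.n∸n≡0 n)

  P′≡!*C : ∀ n k → n P′ k ≡ k ! * (n C k)
  P′≡!*C n k with k ℕ.≤? n
  ... | no k≰n = begin
    n P′ k        ≡⟨ P′-vanish (ℕ.≰⇒> k≰n) ⟩
    0             ≡⟨ ℕ.*-zeroʳ (k !) ⟨
    k ! * 0       ≡⟨ cong (k ! *_) (k>n⇒nCk≡0 (ℕ.≰⇒> k≰n)) ⟨
    k ! * (n C k) ∎
    where open ≡-Reasoning
  ... | yes k≤n = begin
    n P′ k                               ≡⟨ m*[n/m]≡n {{k !≢0}} (k!∣nP′k k≤n) ⟨
    k ! * ((n P′ k) / k !) {{k !≢0}}     ≡⟨ cong (λ p → k ! * (p / k !) {{k !≢0}}) P≡P′ ⟨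
    k ! * ((n P k) / k !) {{k !≢0}}      ≡⟨ cong (k ! *_) (nCk≡nPk/k! k≤n) ⟨
    k ! * (n C k)                        ∎
    where
    open ≡-Reasoning
    P≡P′ : n P k ≡ n P′ k
    P≡P′ = trans (nPk≡n!/[n∸k]! k≤n) (sym (nP′k≡n!/[n∸k]! k≤n))

  module _ {A : Set} (_≟_ : DecidableEquality A) (_⊕_ : A → A → A) (e : A) where
    open Count _≟_ _⊕_ e

    tuples-one : ∀ xs → tuples xs 1 ≡ map Vec.[_] xs
    tuples-one xs = trans (sym (List.concatMap-map [_] Vec.[_] xs)) (List.concatMap-pure (map Vec.[_] xs))

    -- The entries range over the elements of H satisfying G; fixing the first entry a removes a
    -- from G, which is where the falling factorial comes from.
    length-filter-tuples-≤ : ∀ {H} → Unique H → ∀ {k b} {G : A → Set} (G? : Decidable G)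
      {P : Vec A (suc k) → Set} (P? : Decidable P) →
      (∀ {v} → P v → Distinct v × All G (toList v)) →
      (∀ init → length (filter (λ x → P? (init ∷ʳ x)) H) ≤ b) →
      length (filter P? (tuples H (suc k))) ≤ b * (length (filter G? H) P′ k)
    length-filter-tuples-≤ {H} H-unique {zero} {b} G? P? _ bound = begin
      length (filter P? (tuples H 1))      ≡⟨ cong (length ∘ filter P?) (tuples-one H) ⟩
      length (filter P? (map Vec.[_] H))   ≡⟨ length-filter-map P? Vec.[_] H ⟩
      length (filter (P? ∘ Vec.[_]) H)     ≤⟨ bound [] ⟩
      b                                    ≡⟨ ℕ.*-identityʳ b ⟨
      b * 1                                ∎
      where open ℕ.≤-Reasoning
    length-filter-tuples-≤ {H} H-unique {suc k} {b} {G} G? {P} P? P⇒ bound = begin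
      length (filter P? (tuples H (suc (suc k))))
        ≤⟨ length-filter-concatMap-∷-≤ G? P? (tuples H (suc k)) H (All.head ∘ proj₂ ∘ P⇒) block ⟩
      n * (b * (pred n P′ k)) ≡⟨ x∙yz≈y∙xz n b _ ⟩
      b * (n * (pred n P′ k)) ≡⟨ cong (b *_) (P′-pred n k) ⟩
      b * (n P′ suc k)        ∎
      where
      open ℕ.≤-Reasoning
      n = length (filter G? H)
      tail-facts : ∀ {a w} → P (a ∷ w) → Distinct w × All (G ∩ ∁ (a ≡_)) (toList w)
      tail-facts p with P⇒ p
      ... | a∉w ∷ w-distinct , _ ∷ Gw = w-distinct , All.zip (Gw , a∉w)
      block : ∀ {a} → a ∈ H → G a → length (filter (P? ∘ (a ∷_)) (tuples H (suc k))) ≤ b * (pred n P′ k)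
      block {a} a∈H Ga = subst (λ m → _ ≤ b * (m P′ k)) (cong pred (sym removal))
        (length-filter-tuples-≤ H-unique (G? ∩? ∁? (a ≟_)) (P? ∘ (a ∷_)) tail-facts (bound ∘ (a ∷_)))
        where removal = length-filter-remove G? _≟_ H-unique a∈H Ga

  BoundedFibres : {A B : Set} → (A → Set) → (A → B) → ℕ → Set
  BoundedFibres Q f b =
    ∀ {xs} → Unique xs → All Q xs → (∀ {x y} → x ∈ xs → y ∈ xs → f x ≡ f y) → length xs ≤ b

  -- _⊕_ need only behave like a group operation on canonical representatives.
  module _ {A : Set} (_≟_ : DecidableEquality A) (_⊕_ : A → A → A) (e : A)
           {Canonical : A → Set} (⊕-canonical : ∀ x y → Canonical (x ⊕ y))
           (⊕-cancelˡ : ∀ a {x y} → Canonical x → Canonical y → a ⊕ x ≡ a ⊕ y → x ≡ y) where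
    open Count _≟_ _⊕_ e

    linComb-canonical : ∀ {k} (ms : Vec ℕ (suc k)) v → Canonical (linComb ms v)
    linComb-canonical (m ∷ _) (a ∷ _) = ⊕-canonical (mul m a) _

    linComb-∷ʳ-cancel : ∀ {k} (ms : Vec ℕ (suc k)) (init : Vec A k) {x y} →
      linComb ms (init ∷ʳ x) ≡ linComb ms (init ∷ʳ y) → mul (last ms) x ⊕ e ≡ mul (last ms) y ⊕ e
    linComb-∷ʳ-cancel (m ∷ []) [] eq = eq
    linComb-∷ʳ-cancel (m ∷ ms@(_ ∷ _)) (a ∷ init) {x} {y} eq = linComb-∷ʳ-cancel ms init
      (⊕-cancelˡ (mul m a) (linComb-canonical ms (init ∷ʳ x)) (linComb-canonical ms (init ∷ʳ y)) eq)

    count-≤ : ∀ {k b} (ms : Vec ℕ (suc k)) c {H} → Unique H → All Canonical H →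
      BoundedFibres Canonical (λ x → mul (last ms) x ⊕ e) b →
      count ms c H ≤ b * k ! * (length H C k)
    count-≤ {k} {b} ms c {H} H-unique H-canonical fibres = begin
      count ms c H                    ≤⟨ length-filter-tuples-≤ _≟_ _⊕_ e H-unique U? P? P⇒U last-bound ⟩
      b * (length (filter U? H) P′ k) ≡⟨ cong (λ xs → b * (length xs P′ k)) filter-U ⟩
      b * (length H P′ k)             ≡⟨ cong (b *_) (P′≡!*C (length H) k) ⟩
      b * (k ! * (length H C k))      ≡⟨ ℕ.*-assoc b (k !) _ ⟨
      b * k ! * (length H C k)        ∎
      where
      open ℕ.≤-Reasoning
      P? : Decidable (λ v → Distinct v × linComb ms v ≡ c)
      P? v = allPairs? (λ x y → ¬? (x ≟ y)) (toList v) ×-dec (linComb ms v ≟ c)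
      P⇒U : ∀ {v} → Distinct v × linComb ms v ≡ c → Distinct v × All U (toList v)
      P⇒U (v-distinct , _) = v-distinct , All.universal-U _
      filter-U : filter U? H ≡ H
      filter-U = List.filter-all U? (All.universal-U H)
      last-bound : ∀ init → length (filter (λ x → P? (init ∷ʳ x)) H) ≤ b
      last-bound init = ℕ.≤-trans (length-mono-≤ solutions-only)
        (fibres {xs = filter solves? H}
          (Unique.filter⁺ solves? H-unique) (All.filter⁺ solves? H-canonical) same-value)
        where
        solves? : Decidable (λ x → linComb ms (init ∷ʳ x) ≡ c)
        solves? x = linComb ms (init ∷ʳ x) ≟ c
        solutions-only : filter (λ x → P? (init ∷ʳ x)) H ⊆ filter solves? H
        solutions-only = filter⁺ (λ x → P? (init ∷ʳ x)) solves? (λ { refl (_ , eq) → eq }) (⊆-refl {x = H})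
        same-value : ∀ {x y} → x ∈ filter solves? H → y ∈ filter solves? H →
          mul (last ms) x ⊕ e ≡ mul (last ms) y ⊕ e
        same-value x∈ y∈ = linComb-∷ʳ-cancel ms init
          (trans (proj₂ (∈-filter⁻ solves? {xs = H} x∈)) (sym (proj₂ (∈-filter⁻ solves? {xs = H} y∈))))

  BoundedFibres-weaken : ∀ {A B : Set} {Q : A → Set} {f : A → B} {b b′} → b ≤ b′ →
    BoundedFibres Q f b → BoundedFibres Q f b′
  BoundedFibres-weaken b≤b′ fibres xs-unique xs-Q same = ℕ.≤-trans (fibres xs-unique xs-Q same) b≤b′

module ScalingFibres where
  open import Data.List.Relation.Unary.All as All using (All)
  open import Data.Empty using (⊥-elim)
  open TupleCounting using (BoundedFibres; injectiveOn⇒length≤)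
  open ℚ/ℤ using (scaleKey; scaleKey<m; scaleKey-injective)

  ℚ/ℤ-scaling-fibres : ∀ m .{{_ : NonZero m}} → BoundedFibres IsT (λ x → CountT.mul m x ⊕T 0ℚ) m
  ℚ/ℤ-scaling-fibres m xs-unique xs-canonical same =
    injectiveOn⇒length≤ (scaleKey m) xs-unique (scaleKey<m m ∘ All.lookup xs-canonical)
      (λ x∈ y∈ → scaleKey-injective m (All.lookup xs-canonical x∈) (All.lookup xs-canonical y∈) (same x∈ y∈))

  mul-proj₁ : ∀ m p → proj₁ (CountT2.mul m p) ≡ CountT.mul m (proj₁ p)
  mul-proj₁ zero    p = refl
  mul-proj₁ (suc m) p = cong (proj₁ p ⊕T_) (mul-proj₁ m p)

  scaleKey₂ : ℕ → T2 → ℕ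
  scaleKey₂ m (x , false) = scaleKey m x
  scaleKey₂ m (x , true)  = m + scaleKey m x

  T2-scaling-fibres : ∀ m .{{_ : NonZero m}} → BoundedFibres IsT2 (λ p → CountT2.mul m p ⊕T2 0T2) (2 * m)
  T2-scaling-fibres m xs-unique xs-canonical same =
    injectiveOn⇒length≤ (scaleKey₂ m) xs-unique (λ {p} p∈ → key<2m {p} (canonical p∈))
      (λ {p} {q} p∈ q∈ → key-injective {p} {q} (canonical p∈) (canonical q∈) (same p∈ q∈))
    where
    canonical = All.lookup xs-canonical
    key<m+ : ∀ {x} n → IsT x → scaleKey m x < m + n
    key<m+ n x-canonical = ℕ.<-≤-trans (scaleKey<m m x-canonical) (ℕ.m≤m+n m n)
    key<2m : ∀ {p} → IsT2 p → scaleKey₂ m p < 2 * m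
    key<2m {x , false} x-canonical = key<m+ _ x-canonical
    key<2m {x , true}  x-canonical = ℕ.+-monoʳ-< m (key<m+ 0 x-canonical)
    same-proj₁ : ∀ {p q} → CountT2.mul m p ⊕T2 0T2 ≡ CountT2.mul m q ⊕T2 0T2 →
      CountT.mul m (proj₁ p) ⊕T 0ℚ ≡ CountT.mul m (proj₁ q) ⊕T 0ℚ
    same-proj₁ {p} {q} eq = subst₂ (λ x y → x ⊕T 0ℚ ≡ y ⊕T 0ℚ) (mul-proj₁ m p) (mul-proj₁ m q) (cong proj₁ eq)
    key-injective : ∀ {p q} → IsT2 p → IsT2 q → CountT2.mul m p ⊕T2 0T2 ≡ CountT2.mul m q ⊕T2 0T2 →
      scaleKey₂ m p ≡ scaleKey₂ m q → p ≡ q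
    key-injective {x , false} {y , false} x-canonical y-canonical eq same-key =
      cong (_, false) (scaleKey-injective m x-canonical y-canonical (same-proj₁ eq) same-key)
    key-injective {x , true}  {y , true}  x-canonical y-canonical eq same-key =
      cong (_, true) (scaleKey-injective m x-canonical y-canonical (same-proj₁ eq) (ℕ.+-cancelˡ-≡ m _ _ same-key))
    key-injective {x , false} {y , true}  x-canonical _ _ same-key =
      ⊥-elim (ℕ.<⇒≢ (key<m+ _ x-canonical) same-key)
    key-injective {x , true}  {y , false} _ y-canonical _ same-key =
      ⊥-elim (ℕ.<⇒≢ (key<m+ _ y-canonical) (sym same-key))

open import Data.Vec.Relation.Unary.All using (All; []; _∷_)
open import Data.Bool.Properties as BoolP using (not-injective)
open import Data.Product.Properties using (≡-dec)
open TupleCounting using (count-≤; BoundedFibres-weaken)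
open ℚ/ℤ using (⊕T-canonical; ⊕T-cancelˡ)
open ScalingFibres using (ℚ/ℤ-scaling-fibres; T2-scaling-fibres)

xor-cancelˡ : ∀ s {b b′} → s xor b ≡ s xor b′ → b ≡ b′
xor-cancelˡ false eq = eq
xor-cancelˡ true  eq = not-injective eq

⊕T2-canonical : ∀ p q → IsT2 (p ⊕T2 q)
⊕T2-canonical (x , _) (y , _) = ⊕T-canonical x y

⊕T2-cancelˡ : ∀ a {p q} → IsT2 p → IsT2 q → a ⊕T2 p ≡ a ⊕T2 q → p ≡ q
⊕T2-cancelˡ (a , s) {x , _} {y , _} x-canonical y-canonical eq =
  cong₂ _,_ (⊕T-cancelˡ a x-canonical y-canonical (cong proj₁ eq)) (xor-cancelˡ s (cong proj₂ eq))

All-last : ∀ {A : Set} {Q : A → Set} {k} {v : Vec A (suc k)} → All Q v → Q (last v)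
All-last {v = _ ∷ []}    (q ∷ []) = q
All-last {v = _ ∷ _ ∷ _} (_ ∷ qs) = All-last qs

lemma5p3 :
  (∀ (n k : ℕ) (H : List ℚ) (c : ℚ) (ms : Vec ℕ (suc k))
     → CountT.IsFinSubgroup negT IsT H n → c ∈ H → All (λ m → m > 0) ms
     → CountT.count ms c H ≤ 2 * last ms * (k !) * (n C k))
  × (∀ (n k : ℕ) (H : List T2) (c : T2) (ms : Vec ℕ (suc k))
     → CountT2.IsFinSubgroup negT2 IsT2 H n → c ∈ H → All (λ m → m > 0) ms
     → CountT2.count ms c H ≤ 2 * last ms * (k !) * (n C k))
lemma5p3 =
  (λ { n k H c ms (H-unique , refl , H-canonical , _) _ ms-positive →
    let instance _ = ℕ.>-nonZero (All-last ms-positive) in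
    count-≤ ℚP._≟_ _⊕T_ 0ℚ ⊕T-canonical ⊕T-cancelˡ ms c H-unique H-canonical
      (BoundedFibres-weaken (ℕ.m≤n*m (last ms) 2) (ℚ/ℤ-scaling-fibres (last ms))) }) ,
  (λ { n k H c ms (H-unique , refl , H-canonical , _) _ ms-positive →
    let instance _ = ℕ.>-nonZero (All-last ms-positive) in
    count-≤ (≡-dec ℚP._≟_ BoolP._≟_) _⊕T2_ 0T2 ⊕T2-canonical ⊕T2-cancelˡ ms c H-unique H-canonical
      (T2-scaling-fibres (last ms)) })
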